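{- Let $x$ be a complex number and $n$ a nonnegative integer such that all quantities below are defined. Then \[ \sum_{k=0}^n\binom{2n-k}{n}\binom{x+k}{k}H_{k}^{\langle2\rangle}(x)=\frac{\binom{x+2n+1}{n}}{8} \Big\{4H_{2n}^{\langle2\rangle}(x+1) -\big[H_n(\tfrac{x}{2})-H_n(\tfrac{x+1}{2})\big]\big[H_n(\tfrac{x}{2})-H_n(\tfrac{x+1}{2})-\tfrac{4}{x+1}\big]\Big\}. \]
   Context: For a complex $y$ and an integer $k\ge 0$, $\binom{y}{k}=\frac{y(y-1)\cdots(y-k+1)}{k!}$. For complex $x$, integer $n\ge 0$ and positive integer $\ell$: $H_0^{\langle\ell\rangle}(x)=0$, $H_n^{\langle\ell\rangle}(x)=\sum_{k=1}^n\frac{1}{(x+k)^\ell}$, and $H_n(x)=H_n^{\langle1\rangle}(x)$. -}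

module Defs where

open import Level using (Level; _⊔_)
open import Data.Nat as ℕ using (ℕ; zero; suc; _∸_; _!)
open import Relation.Nullary using (¬_)
open import Algebra.Bundles using (CommutativeRing)

-- A field of characteristic zero (ℂ is one), presented as a commutative
-- ring with an inverse operation that is a two-sided inverse on nonzero
-- elements, and in which every positive integer 1+1+…+1 is nonzero.
-- The value of x ⁻¹ at x ≈ 0 is irrelevant: it is never used, since
-- all denominators are assumed nonzero.
-- embedding of ℕ into a ring : ι n = 1 + 1 + ⋯ + 1 (n times)
embed : ∀ {c ℓ} (R : CommutativeRing c ℓ) → ℕ → CommutativeRing.Carrier R
embed R zero = CommutativeRing.0# R
embed R (suc n) = CommutativeRing._+_ R (CommutativeRing.1# R) (embed R n)

record CharZeroField (c ℓ : Level) : Set (Level.suc (c ⊔ ℓ)) where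
  field
    commRing : CommutativeRing c ℓ
  open CommutativeRing commRing public
  field
    _⁻¹ : Carrier → Carrier
    ⁻¹-cong : ∀ {x y} → x ≈ y → x ⁻¹ ≈ y ⁻¹
    ⁻¹-inverse : ∀ x → ¬ (x ≈ 0#) → x * (x ⁻¹) ≈ 1#
    char-zero : ∀ n → ¬ (embed commRing (suc n) ≈ 0#)

module Notation {c ℓ : Level} (F : CharZeroField c ℓ) where
  open CharZeroField F

  ι : ℕ → Carrier
  ι = embed commRing

  _/_ : Carrier → Carrier → Carrier
  a / b = a * (b ⁻¹)

  pow : Carrier → ℕ → Carrier
  pow x zero = 1#
  pow x (suc m) = x * pow x m

  sum0 : ℕ → (ℕ → Carrier) → Carrier
  sum0 zero f = f 0
  sum0 (suc n) f = sum0 n f + f (suc n)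

  sum1 : ℕ → (ℕ → Carrier) → Carrier
  sum1 zero f = 0#
  sum1 (suc n) f = sum1 n f + f (suc n)

  falling : Carrier → ℕ → Carrier
  falling y zero = 1#
  falling y (suc k) = falling y k * (y - ι k)

  binom : Carrier → ℕ → Carrier
  binom y k = falling y k / ι (k !)

  Hgen : ℕ → ℕ → Carrier → Carrier
  Hgen l n x = sum1 n (λ k → 1# / pow (x + ι k) l)

  H : ℕ → Carrier → Carrier
  H n x = Hgen 1 n x

-- Write c(n,k) = C(2n−k, n)·binom(x+k, k) for the weights of the sum. They satisfy the
-- Zeilberger-type recurrence
--   (n+1)(x+n+2)·c(n+1,k) = (x+2n+2)(x+2n+3)·c(n,k) + g(n,k) − g(n,k+1),
-- so, after summation by parts, every sum Σₖ c(n,k)·h(k) satisfies a first-order recurrence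
-- in n whose inhomogeneous part involves only the differences h(k+1) − h(k). For h = 1,
-- h(k) = 1/(x+k+1) and h(k) = H⁽²⁾ₖ(x) these differences lead back to the first two sums,
-- and induction on n gives, with B = binom(x+2n+1, n),
--   Σ c = B,   Σ c/(x+k+1) = B·Aₙ,   2 Σ c·H⁽²⁾ₖ(x) = B·(Sₙ − Aₙ²),
-- where Aₙ and Sₙ are the alternating sum and the sum of squares of 1/(x+j), 1 ≤ j ≤ 2n+1.
-- On the right-hand side, H⁽²⁾₂ₙ(x+1) = Sₙ − 1/(x+1)² and Hₙ(x/2) − Hₙ((x+1)/2) = 2(1/(x+1) − Aₙ).

module Submission where

open import Defs
open import Data.Nat as ℕ using (ℕ; zero; suc; _≤_; _∸_; _!)
open import Data.Nat.Combinatorics using (_C_)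
open import Relation.Nullary using (¬_; yes; no)

open import Algebra.Bundles using (CommutativeRing)
import Data.Integer as ℤ
import Data.Integer.Properties as ℤP
import Data.Sign as Sign
import Data.Nat.Properties as NP
open import Data.Maybe using (Maybe; just; nothing)
import Relation.Binary.PropositionalEquality as ≡
open ≡ using (_≡_)
open import Algebra.Solver.Ring.AlmostCommutativeRing
  using (fromCommutativeRing; _-Raw-AlmostCommutative⟶_)

module IntegerCoefficientSolver {c ℓ} (R : CommutativeRing c ℓ) where
  open ℤ using (ℤ; +_; -[1+_]; _⊖_)
  open CommutativeRing R
  open import Algebra.Properties.Ring ring
  open import Algebra.Properties.Semiring.Mult.TCOptimised semiring
  open import Relation.Binary.Reasoning.Setoid setoid

  -- The optimised _×_ makes ⟦ + 1 ⟧ reduce to 1#, so that solver constants are 0#, 1#, 1# + 1#, ….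
  private
    ⟦_⟧ : ℤ → Carrier
    ⟦ + n ⟧      = n × 1#
    ⟦ -[1+ n ] ⟧ = - (suc n × 1#)

    ⟦-◃⟧ : ∀ n → ⟦ Sign.- ℤ.◃ n ⟧ ≈ - (n × 1#)
    ⟦-◃⟧ zero    = sym -0#≈0#
    ⟦-◃⟧ (suc n) = refl

    ⟦⊖⟧ : ∀ m n → ⟦ m ⊖ n ⟧ ≈ m × 1# - n × 1#
    ⟦⊖⟧ m zero = begin
      ⟦ m ⊖ 0 ⟧      ≡⟨ ≡.cong ⟦_⟧ (ℤP.⊖-≥ {m} ℕ.z≤n) ⟩
      m × 1#         ≈⟨ +-identityʳ _ ⟨
      m × 1# + 0#    ≈⟨ +-congˡ -0#≈0# ⟨
      m × 1# - 0#    ∎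
    ⟦⊖⟧ zero (suc n) = begin
      ⟦ 0 ⊖ suc n ⟧       ≡⟨ ≡.cong ⟦_⟧ (ℤP.⊖-< {0} {suc n} ℕ.z<s) ⟩
      - (suc n × 1#)      ≈⟨ +-identityˡ _ ⟨
      0# - suc n × 1#     ∎
    ⟦⊖⟧ (suc m) (suc n) = begin
      ⟦ suc m ⊖ suc n ⟧                     ≡⟨ ≡.cong ⟦_⟧ (ℤP.[1+m]⊖[1+n]≡m⊖n m n) ⟩
      ⟦ m ⊖ n ⟧                             ≈⟨ ⟦⊖⟧ m n ⟩
      a - b                                 ≈⟨ +-congʳ (xyx⁻¹≈y 1# a) ⟨
      (1# + a) - 1# - b                     ≈⟨ +-assoc _ _ _ ⟩
      (1# + a) + (- 1# - b)                 ≈⟨ +-cong (sym (1+× m 1#)) (-‿+-comm 1# b) ⟩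
      suc m × 1# - (1# + b)                 ≈⟨ +-congˡ (-‿cong (1+× n 1#)) ⟨
      suc m × 1# - suc n × 1#               ∎
      where a = m × 1#; b = n × 1#

    ⟦+⟧ : ∀ i j → ⟦ i ℤ.+ j ⟧ ≈ ⟦ i ⟧ + ⟦ j ⟧
    ⟦+⟧ (+ m)      (+ n)      = ×-homo-+ 1# m n
    ⟦+⟧ (+ m)      -[1+ n ]   = ⟦⊖⟧ m (suc n)
    ⟦+⟧ -[1+ m ]   (+ n)      = trans (⟦⊖⟧ n (suc m)) (+-comm _ _)
    ⟦+⟧ -[1+ m ]   -[1+ n ]   = begin
      - (suc (suc (m ℕ.+ n)) × 1#)        ≡⟨ ≡.cong (λ k → - (suc k × 1#)) (NP.+-suc m n) ⟨
      - ((suc m ℕ.+ suc n) × 1#)          ≈⟨ -‿cong (×-homo-+ 1# (suc m) (suc n)) ⟩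
      - (suc m × 1# + suc n × 1#)         ≈⟨ -‿+-comm _ _ ⟨
      - (suc m × 1#) - suc n × 1#         ∎

    ⟦*⟧ : ∀ i j → ⟦ i ℤ.* j ⟧ ≈ ⟦ i ⟧ * ⟦ j ⟧
    ⟦*⟧ (+ m)      (+ n)      = trans (reflexive (≡.cong ⟦_⟧ (ℤP.+◃n≡+n (m ℕ.* n)))) (×1-homo-* m n)
    ⟦*⟧ (+ m)      -[1+ n ]   = trans (⟦-◃⟧ (m ℕ.* suc n))
      (trans (-‿cong (×1-homo-* m (suc n))) (-‿distribʳ-* _ _))
    ⟦*⟧ -[1+ m ]   (+ n)      = trans (⟦-◃⟧ (suc m ℕ.* n))
      (trans (-‿cong (×1-homo-* (suc m) n)) (-‿distribˡ-* _ _))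
    ⟦*⟧ -[1+ m ]   -[1+ n ]   = begin
      ⟦ Sign.+ ℤ.◃ (suc m ℕ.* suc n) ⟧     ≡⟨ ≡.cong ⟦_⟧ (ℤP.+◃n≡+n (suc m ℕ.* suc n)) ⟩
      (suc m ℕ.* suc n) × 1#              ≈⟨ ×1-homo-* (suc m) (suc n) ⟩
      a * b                               ≈⟨ -‿involutive _ ⟨
      - - (a * b)                         ≈⟨ -‿cong (-‿distribˡ-* a b) ⟩
      - (- a * b)                         ≈⟨ -‿distribʳ-* _ _ ⟩
      - a * - b                           ∎
      where a = suc m × 1#; b = suc n × 1#

    ⟦-⟧ : ∀ i → ⟦ ℤ.- i ⟧ ≈ - ⟦ i ⟧
    ⟦-⟧ (+ zero)   = sym -0#≈0#
    ⟦-⟧ (+ suc n)  = refl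
    ⟦-⟧ -[1+ n ]   = sym (-‿involutive _)

    ℤ⟶R : ℤ.+-*-rawRing -Raw-AlmostCommutative⟶ fromCommutativeRing R
    ℤ⟶R = record
      { ⟦_⟧    = ⟦_⟧
      ; +-homo = ⟦+⟧
      ; *-homo = ⟦*⟧
      ; -‿homo = ⟦-⟧
      ; 0-homo = refl
      ; 1-homo = refl
      }

    ⟦⟧-≟ : ∀ i j → Maybe (⟦ i ⟧ ≈ ⟦ j ⟧)
    ⟦⟧-≟ i j with i ℤ.≟ j
    ... | yes ≡.refl = just refl
    ... | no _       = nothing

  open import Algebra.Solver.Ring ℤ.+-*-rawRing (fromCommutativeRing R) ℤ⟶R ⟦⟧-≟ public

  κ : ∀ {m} → ℕ → Polynomial m
  κ n = con (+ n)

  -- Unlike κ n, the polynomial ιᴾ n evaluates to embed R n itself.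
  ιᴾ : ∀ {m} → ℕ → Polynomial m
  ιᴾ zero    = κ 0
  ιᴾ (suc n) = κ 1 :+ ιᴾ n

module _ where
  open import Data.Nat using (_+_; _*_)
  open import Data.Nat.Properties
  open import Data.Nat.Combinatorics using (nCn≡1; nC1≡n; nCk≡nC[n∸k]; nCk+nC[k+1]≡[n+1]C[k+1])
  open import Data.Nat.Solver using (module +-*-Solver)
  open +-*-Solver using (_:=_; _:+_; _:*_; con) renaming (solve to +-*-solve)
  open import Relation.Binary.PropositionalEquality

  C-absorb : ∀ n k → suc k * (suc n C suc k) ≡ suc n * (n C k)
  C-absorb zero    zero    = refl
  C-absorb zero    (suc k) = *-zeroʳ (suc (suc k))
  C-absorb (suc n) zero    = begin
    1 * (suc (suc n) C 1)   ≡⟨ *-identityˡ _ ⟩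
    suc (suc n) C 1         ≡⟨ nC1≡n (suc (suc n)) ⟩
    suc (suc n)             ≡⟨ *-identityʳ _ ⟨
    suc (suc n) * (suc n C 0) ∎
    where open ≡-Reasoning
  C-absorb (suc n) (suc k) = begin
    (2 + k) * ((2 + n) C (2 + k))                   ≡⟨ cong ((2 + k) *_) (nCk+nC[k+1]≡[n+1]C[k+1] (suc n) (suc k)) ⟨
    (2 + k) * (a + b)
      ≡⟨ +-*-solve 3 (λ k a b → (con 2 :+ k) :* (a :+ b) := a :+ ((con 1 :+ k) :* a :+ (con 2 :+ k) :* b)) refl k a b ⟩
    a + ((1 + k) * a + (2 + k) * b)                 ≡⟨ cong (a +_) (cong₂ _+_ (C-absorb n k) (C-absorb n (suc k))) ⟩
    a + ((1 + n) * (n C k) + (1 + n) * (n C suc k)) ≡⟨ cong (a +_) (*-distribˡ-+ (1 + n) (n C k) (n C suc k)) ⟨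
    a + (1 + n) * (n C k + n C suc k)               ≡⟨ cong (λ t → a + (1 + n) * t) (nCk+nC[k+1]≡[n+1]C[k+1] n k) ⟩
    a + (1 + n) * a                                 ∎
    where
    open ≡-Reasoning
    a = suc n C suc k
    b = suc n C suc (suc k)

  C-absorb′ : ∀ n m → suc m * (suc (n + m) C n) ≡ suc (n + m) * ((n + m) C n)
  C-absorb′ n m = begin
    suc m * (suc (n + m) C n)         ≡⟨ cong (suc m *_) (nCk≡nC[n∸k] (m≤n⇒m≤1+n (m≤m+n n m))) ⟩
    suc m * (suc (n + m) C (suc (n + m) ∸ n))  ≡⟨ cong (λ t → suc m * (suc (n + m) C t)) ([1+n+m]∸n≡1+m) ⟩
    suc m * (suc (n + m) C suc m)     ≡⟨ cong (λ t → suc m * (suc t C suc m)) (+-comm n m) ⟩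
    suc m * (suc (m + n) C suc m)     ≡⟨ C-absorb (m + n) m ⟩
    suc (m + n) * ((m + n) C m)       ≡⟨ cong (λ t → suc t * (t C m)) (+-comm m n) ⟩
    suc (n + m) * ((n + m) C m)       ≡⟨ cong (suc (n + m) *_) (nCk≡nC[n∸k] (m≤n+m m n)) ⟩
    suc (n + m) * ((n + m) C (n + m ∸ m)) ≡⟨ cong (λ t → suc (n + m) * ((n + m) C t)) (m+n∸n≡m n m) ⟩
    suc (n + m) * ((n + m) C n)       ∎
    where
    open ≡-Reasoning
    [1+n+m]∸n≡1+m : suc (n + m) ∸ n ≡ suc m
    [1+n+m]∸n≡1+m = trans (cong (_∸ n) (sym (+-suc n m))) (m+n∸m≡n n (suc m))

  [2n∸n]Cn≡1 : ∀ n → (2 * n ∸ n) C n ≡ 1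
  [2n∸n]Cn≡1 n = trans (cong (_C n) (trans (m+n∸m≡n n (n + 0)) (+-identityʳ n))) (nCn≡1 n)

  j+2n∸k≡j+[n+[n∸k]] : ∀ j {k n} → k ≤ n → j + 2 * n ∸ k ≡ j + (n + (n ∸ k))
  j+2n∸k≡j+[n+[n∸k]] j {k} {n} k≤n = begin
    j + 2 * n ∸ k        ≡⟨ +-∸-assoc j (≤-trans k≤n (m≤m+n n (n + 0))) ⟩
    j + (2 * n ∸ k)      ≡⟨ cong (λ t → j + (n + t ∸ k)) (+-identityʳ n) ⟩
    j + (n + n ∸ k)      ≡⟨ cong (j +_) (+-∸-assoc n k≤n) ⟩
    j + (n + (n ∸ k))    ∎
    where open ≡-Reasoning

  C-absorb-2n∸k : ∀ {k n} → k ≤ n →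
    suc n * ((2 * suc n ∸ k) C suc n) ≡ (2 + (n + (n ∸ k))) * ((1 + 2 * n ∸ k) C n)
  C-absorb-2n∸k {k} {n} k≤n = begin
    suc n * ((2 * suc n ∸ k) C suc n)               ≡⟨ cong (λ t → suc n * ((t ∸ k) C suc n)) (*-suc 2 n) ⟩
    suc n * ((2 + 2 * n ∸ k) C suc n)               ≡⟨ cong (λ t → suc n * (t C suc n)) (j+2n∸k≡j+[n+[n∸k]] 2 k≤n) ⟩
    suc n * ((2 + (n + (n ∸ k))) C suc n)           ≡⟨ C-absorb (suc (n + (n ∸ k))) n ⟩
    (2 + (n + (n ∸ k))) * ((1 + (n + (n ∸ k))) C n) ≡⟨ cong (λ t → (2 + (n + (n ∸ k))) * (t C n)) (j+2n∸k≡j+[n+[n∸k]] 1 k≤n) ⟨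
    (2 + (n + (n ∸ k))) * ((1 + 2 * n ∸ k) C n)     ∎
    where open ≡-Reasoning

  C-absorb′-2n∸k : ∀ {k n} → k ≤ n →
    suc (n ∸ k) * ((1 + 2 * n ∸ k) C n) ≡ (1 + (n + (n ∸ k))) * ((2 * n ∸ k) C n)
  C-absorb′-2n∸k {k} {n} k≤n = begin
    suc (n ∸ k) * ((1 + 2 * n ∸ k) C n)         ≡⟨ cong (λ t → suc (n ∸ k) * (t C n)) (j+2n∸k≡j+[n+[n∸k]] 1 k≤n) ⟩
    suc (n ∸ k) * ((1 + (n + (n ∸ k))) C n)     ≡⟨ C-absorb′ n (n ∸ k) ⟩
    (1 + (n + (n ∸ k))) * ((n + (n ∸ k)) C n)   ≡⟨ cong (λ t → (1 + (n + (n ∸ k))) * (t C n)) (j+2n∸k≡j+[n+[n∸k]] 0 k≤n) ⟨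
    (1 + (n + (n ∸ k))) * ((2 * n ∸ k) C n)     ∎
    where open ≡-Reasoning

module _ {c ℓ} (F : CharZeroField c ℓ) where
  open CharZeroField F
  open Notation F
  open IntegerCoefficientSolver commRing
  open import Relation.Binary.Reasoning.Setoid setoid

  ι-+ : ∀ m n → ι (m ℕ.+ n) ≈ ι m + ι n
  ι-+ zero    n = sym (+-identityˡ _)
  ι-+ (suc m) n = trans (+-congˡ (ι-+ m n)) (sym (+-assoc _ _ _))

  ι-* : ∀ m n → ι (m ℕ.* n) ≈ ι m * ι n
  ι-* zero    n = sym (zeroˡ _)
  ι-* (suc m) n = begin
    ι (n ℕ.+ m ℕ.* n)     ≈⟨ ι-+ n (m ℕ.* n) ⟩
    ι n + ι (m ℕ.* n)     ≈⟨ +-cong (sym (*-identityˡ _)) (ι-* m n) ⟩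
    1# * ι n + ι m * ι n  ≈⟨ distribʳ _ _ _ ⟨
    ι (suc m) * ι n       ∎

  ι-2* : ∀ n → ι (2 ℕ.* n) ≈ ι n + ι n
  ι-2* n = trans (ι-+ n (n ℕ.+ 0)) (+-congˡ (reflexive (≡.cong ι (NP.+-identityʳ n))))

  ≡⇒ι*≈ι* : ∀ a b c d → a ℕ.* b ≡ c ℕ.* d → ι a * ι b ≈ ι c * ι d
  ≡⇒ι*≈ι* a b c d e = trans (sym (ι-* a b)) (trans (reflexive (≡.cong ι e)) (ι-* c d))

  ι[2n∸n]Cn≈1 : ∀ n → ι ((2 ℕ.* n ∸ n) C n) ≈ 1#
  ι[2n∸n]Cn≈1 n = trans (reflexive (≡.cong ι ([2n∸n]Cn≡1 n))) (+-identityʳ 1#)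

  ι≉0 : ∀ n → .{{ℕ.NonZero n}} → ¬ (ι n ≈ 0#)
  ι≉0 (suc n) = char-zero n

  1≉0 : ¬ (1# ≈ 0#)
  1≉0 1≈0 = char-zero 0 (trans (+-identityʳ 1#) 1≈0)

  ⁻¹-inverseˡ : ∀ {a} → ¬ (a ≈ 0#) → a ⁻¹ * a ≈ 1#
  ⁻¹-inverseˡ {a} a≉0 = trans (*-comm _ _) (⁻¹-inverse a a≉0)

  *≈1⇒≉0 : ∀ {a b} → a * b ≈ 1# → ¬ (a ≈ 0#)
  *≈1⇒≉0 {a} {b} ab≈1 a≈0 = 1≉0 (begin
    1#      ≈⟨ ab≈1 ⟨
    a * b   ≈⟨ *-congʳ a≈0 ⟩
    0# * b  ≈⟨ zeroˡ b ⟩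
    0#      ∎)

  *-cancelˡ : ∀ {a b d} → ¬ (a ≈ 0#) → a * b ≈ a * d → b ≈ d
  *-cancelˡ {a} {b} {d} a≉0 ab≈ad = begin
    b                ≈⟨ *-identityˡ b ⟨
    1# * b           ≈⟨ *-congʳ (⁻¹-inverseˡ a≉0) ⟨
    (a ⁻¹ * a) * b   ≈⟨ *-assoc _ _ _ ⟩
    a ⁻¹ * (a * b)   ≈⟨ *-congˡ ab≈ad ⟩
    a ⁻¹ * (a * d)   ≈⟨ *-assoc _ _ _ ⟨
    (a ⁻¹ * a) * d   ≈⟨ *-congʳ (⁻¹-inverseˡ a≉0) ⟩
    1# * d           ≈⟨ *-identityˡ d ⟩
    d                ∎

  ⁻¹-unique : ∀ {a b} → a * b ≈ 1# → a ⁻¹ ≈ b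
  ⁻¹-unique {a} {b} ab≈1 = *-cancelˡ (*≈1⇒≉0 ab≈1) (trans (⁻¹-inverse a (*≈1⇒≉0 ab≈1)) (sym ab≈1))

  *-≉0 : ∀ {a b} → ¬ (a ≈ 0#) → ¬ (b ≈ 0#) → ¬ (a * b ≈ 0#)
  *-≉0 {a} a≉0 b≉0 ab≈0 = b≉0 (*-cancelˡ a≉0 (trans ab≈0 (sym (zeroʳ a))))

  pow-*-inverse : ∀ {p w} l → p * w ≈ 1# → pow p l * pow w l ≈ 1#
  pow-*-inverse zero    pw≈1 = *-identityˡ 1#
  pow-*-inverse {p} {w} (suc l) pw≈1 = begin
    (p * pow p l) * (w * pow w l)   ≈⟨ solve 4 (λ p P w W → (p :* P) :* (w :* W) := (p :* w) :* (P :* W)) refl p (pow p l) w (pow w l) ⟩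
    (p * w) * (pow p l * pow w l)   ≈⟨ *-cong pw≈1 (pow-*-inverse l pw≈1) ⟩
    1# * 1#                         ≈⟨ *-identityˡ 1# ⟩
    1#                              ∎

  1/pow≈pow : ∀ {p w} l → p * w ≈ 1# → 1# / pow p l ≈ pow w l
  1/pow≈pow l pw≈1 = trans (*-identityˡ _) (⁻¹-unique (pow-*-inverse l pw≈1))

  sum0-cong : ∀ n {f g : ℕ → Carrier} → (∀ k → k ≤ n → f k ≈ g k) → sum0 n f ≈ sum0 n g
  sum0-cong zero    f≈g = f≈g 0 ℕ.z≤n
  sum0-cong (suc n) f≈g = +-cong (sum0-cong n (λ k k≤n → f≈g k (NP.m≤n⇒m≤1+n k≤n))) (f≈g (suc n) NP.≤-refl)

  sum0-≈0 : ∀ n {f : ℕ → Carrier} → (∀ k → f k ≈ 0#) → sum0 n f ≈ 0#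
  sum0-≈0 zero    f≈0 = f≈0 0
  sum0-≈0 (suc n) f≈0 = trans (+-cong (sum0-≈0 n f≈0) (f≈0 (suc n))) (+-identityʳ 0#)

  sum0-+ : ∀ n (f g : ℕ → Carrier) → sum0 n (λ k → f k + g k) ≈ sum0 n f + sum0 n g
  sum0-+ zero    f g = refl
  sum0-+ (suc n) f g = trans (+-congʳ (sum0-+ n f g))
    (solve 4 (λ a b c d → (a :+ b) :+ (c :+ d) := (a :+ c) :+ (b :+ d)) refl _ _ _ _)

  *-distribˡ-sum0 : ∀ n a (f : ℕ → Carrier) → a * sum0 n f ≈ sum0 n (λ k → a * f k)
  *-distribˡ-sum0 zero    a f = refl
  *-distribˡ-sum0 (suc n) a f = trans (distribˡ _ _ _) (+-congʳ (*-distribˡ-sum0 n a f))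

  -‿sum0 : ∀ n (f : ℕ → Carrier) → sum0 n (λ k → - f k) ≈ - sum0 n f
  -‿sum0 zero    f = refl
  -‿sum0 (suc n) f = trans (+-congʳ (-‿sum0 n f)) (solve 2 (λ a b → (:- a) :+ (:- b) := :- (a :+ b)) refl _ _)

  sum0-by-parts : ∀ n (g h : ℕ → Carrier) →
    sum0 n (λ k → (g k - g (suc k)) * h k) + g (suc n) * h (suc n)
      ≈ g 0 * h 0 + sum0 n (λ j → g (suc j) * (h (suc j) - h j))
  sum0-by-parts zero    g h = solve 4 (λ g0 g1 h0 h1 → (g0 :- g1) :* h0 :+ g1 :* h1 := g0 :* h0 :+ g1 :* (h1 :- h0)) refl _ _ _ _
  sum0-by-parts (suc n) g h = begin
    (Σ + (g (suc n) - g (suc (suc n))) * h (suc n)) + g (suc (suc n)) * h (suc (suc n))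
      ≈⟨ solve 5 (λ Σ g₁ g₂ h₁ h₂ → (Σ :+ (g₁ :- g₂) :* h₁) :+ g₂ :* h₂
                                 := (Σ :+ g₁ :* h₁) :+ g₂ :* (h₂ :- h₁)) refl _ _ _ _ _ ⟩
    (Σ + g (suc n) * h (suc n)) + g (suc (suc n)) * (h (suc (suc n)) - h (suc n))
      ≈⟨ +-congʳ (sum0-by-parts n g h) ⟩
    (g 0 * h 0 + Σ′) + g (suc (suc n)) * (h (suc (suc n)) - h (suc n))
      ≈⟨ +-assoc _ _ _ ⟩
    g 0 * h 0 + sum0 (suc n) (λ j → g (suc j) * (h (suc j) - h j)) ∎
    where
    Σ  = sum0 n (λ k → (g k - g (suc k)) * h k)
    Σ′ = sum0 n (λ j → g (suc j) * (h (suc j) - h j))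

  creative-telescoping : ∀ n {d r : Carrier} (c c′ g h : ℕ → Carrier) →
    (∀ k → k ≤ n → d * c′ k ≈ r * c k + (g k - g (suc k))) →
    d * c′ (suc n) ≈ g (suc n) →
    g 0 ≈ 0# →
    d * sum0 (suc n) (λ k → c′ k * h k)
      ≈ r * sum0 n (λ k → c k * h k) + sum0 n (λ j → g (suc j) * (h (suc j) - h j))
  creative-telescoping n {d} {r} c c′ g h certificate boundary g0≈0 = begin
    d * (sum0 n (λ k → c′ k * h k) + c′ (suc n) * h (suc n))
      ≈⟨ distribˡ _ _ _ ⟩
    d * sum0 n (λ k → c′ k * h k) + d * (c′ (suc n) * h (suc n))
      ≈⟨ +-cong (*-distribˡ-sum0 n d _) (trans (sym (*-assoc _ _ _)) (*-congʳ boundary)) ⟩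
    sum0 n (λ k → d * (c′ k * h k)) + g (suc n) * h (suc n)
      ≈⟨ +-congʳ (sum0-cong n (λ k k≤n → termwise k (certificate k k≤n))) ⟩
    sum0 n (λ k → r * (c k * h k) + (g k - g (suc k)) * h k) + g (suc n) * h (suc n)
      ≈⟨ +-congʳ (sum0-+ n _ _) ⟩
    (sum0 n (λ k → r * (c k * h k)) + sum0 n (λ k → (g k - g (suc k)) * h k)) + g (suc n) * h (suc n)
      ≈⟨ +-assoc _ _ _ ⟩
    sum0 n (λ k → r * (c k * h k)) + (sum0 n (λ k → (g k - g (suc k)) * h k) + g (suc n) * h (suc n))
      ≈⟨ +-cong (sym (*-distribˡ-sum0 n r _)) (sum0-by-parts n g h) ⟩
    r * sum0 n (λ k → c k * h k) + (g 0 * h 0 + Σ)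
      ≈⟨ +-congˡ (trans (+-congʳ (trans (*-congʳ g0≈0) (zeroˡ _))) (+-identityˡ Σ)) ⟩
    r * sum0 n (λ k → c k * h k) + Σ ∎
    where
    Σ = sum0 n (λ j → g (suc j) * (h (suc j) - h j))
    termwise : ∀ k → d * c′ k ≈ r * c k + (g k - g (suc k)) →
               d * (c′ k * h k) ≈ r * (c k * h k) + (g k - g (suc k)) * h k
    termwise k step = begin
      d * (c′ k * h k)                        ≈⟨ *-assoc _ _ _ ⟨
      (d * c′ k) * h k                        ≈⟨ *-congʳ step ⟩
      (r * c k + (g k - g (suc k))) * h k
        ≈⟨ solve 5 (λ r c a b h → (r :* c :+ (a :- b)) :* h := r :* (c :* h) :+ (a :- b) :* h) refl _ _ _ _ _ ⟩
      r * (c k * h k) + (g k - g (suc k)) * h k ∎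

  ι!≉0 : ∀ k → ¬ (ι (k !) ≈ 0#)
  ι!≉0 k = ι≉0 (k !) {{k NP.!≢0}}

  ι[1+k]!⁻¹*ι[1+k]≈ιk!⁻¹ : ∀ k → ι (suc k !) ⁻¹ * ι (suc k) ≈ ι (k !) ⁻¹
  ι[1+k]!⁻¹*ι[1+k]≈ιk!⁻¹ k = *-cancelˡ (ι!≉0 k) (begin
    f * (ι (suc k !) ⁻¹ * s)      ≈⟨ solve 3 (λ f i s → f :* (i :* s) := (s :* f) :* i) refl f _ s ⟩
    (s * f) * ι (suc k !) ⁻¹      ≈⟨ *-congʳ (ι-* (suc k) (k !)) ⟨
    ι (suc k !) * ι (suc k !) ⁻¹  ≈⟨ ⁻¹-inverse _ (ι!≉0 (suc k)) ⟩
    1#                            ≈⟨ ⁻¹-inverse _ (ι!≉0 k) ⟨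
    f * f ⁻¹                      ∎)
    where s = ι (suc k); f = ι (k !)

  falling-cong : ∀ k {y z} → y ≈ z → falling y k ≈ falling z k
  falling-cong zero    y≈z = refl
  falling-cong (suc k) y≈z = *-cong (falling-cong k y≈z) (+-congʳ y≈z)

  binom-cong : ∀ k {y z} → y ≈ z → binom y k ≈ binom z k
  binom-cong k y≈z = *-congʳ (falling-cong k y≈z)

  falling-sucˡ : ∀ k y → falling y (suc k) ≈ y * falling (y - 1#) k
  falling-sucˡ zero    y = solve 1 (λ y → κ 1 :* (y :- κ 0) := y :* κ 1) refl y
  falling-sucˡ (suc k) y = begin
    falling y (suc k) * (y - ι (suc k))            ≈⟨ *-congʳ (falling-sucˡ k y) ⟩
    (y * falling (y - 1#) k) * (y - (1# + ι k))
      ≈⟨ solve 3 (λ y f i → (y :* f) :* (y :- (κ 1 :+ i)) := y :* (f :* ((y :- κ 1) :- i))) refl y _ _ ⟩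
    y * (falling (y - 1#) k * ((y - 1#) - ι k))    ∎

  binom-absorb : ∀ k y → binom y (suc k) * ι (suc k) ≈ y * binom (y - 1#) k
  binom-absorb k y = begin
    (falling y (suc k) * ι (suc k !) ⁻¹) * ι (suc k)  ≈⟨ *-assoc _ _ _ ⟩
    falling y (suc k) * (ι (suc k !) ⁻¹ * ι (suc k))  ≈⟨ *-cong (falling-sucˡ k y) (ι[1+k]!⁻¹*ι[1+k]≈ιk!⁻¹ k) ⟩
    (y * falling (y - 1#) k) * ι (k !) ⁻¹             ≈⟨ *-assoc _ _ _ ⟩
    y * binom (y - 1#) k                              ∎

  binom-shift : ∀ k y → binom y k * (y - ι k) ≈ y * binom (y - 1#) k
  binom-shift k y = begin
    (falling y k * w) * (y - ι k)          ≈⟨ solve 3 (λ f w d → (f :* w) :* d := (f :* d) :* w) refl _ w _ ⟩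
    falling y (suc k) * w                  ≈⟨ *-congʳ (falling-sucˡ k y) ⟩
    (y * falling (y - 1#) k) * w           ≈⟨ *-assoc _ _ _ ⟩
    y * binom (y - 1#) k                   ∎
    where w = ι (k !) ⁻¹

  reciprocal-difference : ∀ X i w v → (X + i) * w ≈ 1# → (X + (1# + i)) * v ≈ 1# →
    ((X + i) * (X + (1# + i))) * (v - w) ≈ - 1#
  reciprocal-difference X i w v hw hv = begin
    ((X + i) * (X + (1# + i))) * (v - w)
      ≈⟨ solve 4 (λ X i w v → ((X :+ i) :* (X :+ (κ 1 :+ i))) :* (v :- w)
                           := (X :+ i) :* ((X :+ (κ 1 :+ i)) :* v) :- (X :+ (κ 1 :+ i)) :* ((X :+ i) :* w)) refl X i w v ⟩
    (X + i) * ((X + (1# + i)) * v) - (X + (1# + i)) * ((X + i) * w)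
      ≈⟨ +-cong (*-congˡ hv) (-‿cong (*-congˡ hw)) ⟩
    (X + i) * 1# - (X + (1# + i)) * 1#
      ≈⟨ solve 2 (λ X i → (X :+ i) :* κ 1 :- (X :+ (κ 1 :+ i)) :* κ 1 := :- κ 1) refl X i ⟩
    - 1# ∎

  reciprocal-square : ∀ X i w → (X + i) * w ≈ 1# → ((X + i) * (X + (1# + i))) * (w * w) ≈ 1# + w
  reciprocal-square X i w hw = begin
    ((X + i) * (X + (1# + i))) * (w * w)
      ≈⟨ solve 3 (λ X i w → ((X :+ i) :* (X :+ (κ 1 :+ i))) :* (w :* w) := ((X :+ i) :* w) :* (((X :+ i) :* w) :+ w)) refl X i w ⟩
    ((X + i) * w) * (((X + i) * w) + w)
      ≈⟨ *-cong hw (+-congʳ hw) ⟩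
    1# * (1# + w)
      ≈⟨ *-identityˡ _ ⟩
    1# + w ∎

  telescoping-certificate : ∀ X K M P Q R b b′ → let N = K + M in
    (1# + N) * R ≈ (1# + (1# + (N + M))) * Q →
    (1# + M) * Q ≈ (1# + (N + M)) * P →
    b′ * (1# + K) ≈ b * (X + (1# + K)) →
    ¬ (1# + M ≈ 0#) →
    ((1# + N) * (X + (1# + (1# + N)))) * (R * b)
      ≈ ((X + (1# + (1# + (N + N)))) * (X + (1# + (1# + (1# + (N + N)))))) * (P * b)
        + (((K * (X + (1# + K))) * Q) * b - (((1# + K) * (X + (1# + (1# + K)))) * P) * b′)
  -- Multiplied by 1 + M, both sides become multiples of P·b by hR, hQ and hb, and what is
  -- left is a polynomial identity in X, K and M.
  telescoping-certificate X K M P Q R b b′ hR hQ hb 1+M≉0 = *-cancelˡ 1+M≉0 (begin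
    (1# + M) * (((1# + N) * (X + (1# + (1# + N)))) * (R * b))
      ≈⟨ solve 5 (λ X K M R b → let N = K :+ M in
           (κ 1 :+ M) :* (((κ 1 :+ N) :* (X :+ (κ 1 :+ (κ 1 :+ N)))) :* (R :* b))
           := ((X :+ (κ 2 :+ N)) :* (κ 1 :+ M) :* b) :* ((κ 1 :+ N) :* R)) refl X K M R b ⟩
    ((X + (1# + 1# + N)) * (1# + M) * b) * ((1# + N) * R)
      ≈⟨ *-congˡ hR ⟩
    ((X + (1# + 1# + N)) * (1# + M) * b) * ((1# + (1# + (N + M))) * Q)
      ≈⟨ solve 5 (λ X K M Q b → let N = K :+ M in
           ((X :+ (κ 2 :+ N)) :* (κ 1 :+ M) :* b) :* ((κ 1 :+ (κ 1 :+ (N :+ M))) :* Q)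
           := ((X :+ (κ 2 :+ N)) :* (κ 2 :+ (N :+ M)) :* b) :* ((κ 1 :+ M) :* Q)) refl X K M Q b ⟩
    ((X + (1# + 1# + N)) * (1# + 1# + (N + M)) * b) * ((1# + M) * Q)
      ≈⟨ *-congˡ hQ ⟩
    ((X + (1# + 1# + N)) * (1# + 1# + (N + M)) * b) * ((1# + (N + M)) * P)
      ≈⟨ solve 5 (λ X K M P b → let N = K :+ M in
           ((X :+ (κ 2 :+ N)) :* (κ 2 :+ (N :+ M)) :* b) :* ((κ 1 :+ (N :+ M)) :* P)
           := (κ 1 :+ M) :* (ρᴾ X N :* (P :* b)) :+ ((K :* (X :+ (κ 1 :+ K))) :* b) :* ((κ 1 :+ (N :+ M)) :* P)
              :- ((κ 1 :+ M) :* (X :+ (κ 2 :+ K)) :* P) :* (b :* (X :+ (κ 1 :+ K)))) refl X K M P b ⟩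
    (1# + M) * (ρ * (P * b)) + ((K * (X + (1# + K))) * b) * ((1# + (N + M)) * P)
      - ((1# + M) * (X + (1# + 1# + K)) * P) * (b * (X + (1# + K)))
      ≈⟨ +-cong (+-congˡ (*-congˡ hQ)) (-‿cong (*-congˡ hb)) ⟨
    (1# + M) * (ρ * (P * b)) + ((K * (X + (1# + K))) * b) * ((1# + M) * Q)
      - ((1# + M) * (X + (1# + 1# + K)) * P) * (b′ * (1# + K))
      ≈⟨ solve 7 (λ X K M P Q b b′ → let N = K :+ M in
           (κ 1 :+ M) :* (ρᴾ X N :* (P :* b)) :+ ((K :* (X :+ (κ 1 :+ K))) :* b) :* ((κ 1 :+ M) :* Q)
             :- ((κ 1 :+ M) :* (X :+ (κ 2 :+ K)) :* P) :* (b′ :* (κ 1 :+ K))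
           := (κ 1 :+ M) :* (ρᴾ X N :* (P :* b) :+ (((K :* (X :+ (κ 1 :+ K))) :* Q) :* b
                :- (((κ 1 :+ K) :* (X :+ (κ 1 :+ (κ 1 :+ K)))) :* P) :* b′))) refl X K M P Q b b′ ⟩
    (1# + M) * (ρ * (P * b) + (((K * (X + (1# + K))) * Q) * b - (((1# + K) * (X + (1# + (1# + K)))) * P) * b′)) ∎)
    where
    N = K + M
    ρ = (X + (1# + (1# + (N + N)))) * (X + (1# + (1# + (1# + (N + N)))))
    ρᴾ : ∀ {m} → Polynomial m → Polynomial m → Polynomial m
    ρᴾ X N = (X :+ (κ 1 :+ (κ 1 :+ (N :+ N)))) :* (X :+ (κ 1 :+ (κ 1 :+ (κ 1 :+ (N :+ N)))))

  +ι[1+m]-1≈+ιm : ∀ y m → (y + ι (suc m)) - 1# ≈ y + ι m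
  +ι[1+m]-1≈+ιm y m = solve 2 (λ y i → (y :+ (κ 1 :+ i)) :- κ 1 := y :+ i) refl y (ι m)

  half-shift-inverse : ∀ y m w → (y + ι (2 ℕ.* m)) * w ≈ 1# → (y / ι 2 + ι m) * (ι 2 * w) ≈ 1#
  half-shift-inverse y m w yw≈1 = begin
    (y * ι 2 ⁻¹ + ι m) * (ι 2 * w)
      ≈⟨ solve 4 (λ y t i w → (y :* t :+ i) :* (ιᴾ 2 :* w) := (y :* (ιᴾ 2 :* t) :+ (i :+ i)) :* w) refl y _ (ι m) w ⟩
    (y * (ι 2 * ι 2 ⁻¹) + (ι m + ι m)) * w
      ≈⟨ *-congʳ (+-cong (trans (*-congˡ (⁻¹-inverse _ (char-zero 1))) (*-identityʳ y)) (sym (ι-2* m))) ⟩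
    (y + ι (2 ℕ.* m)) * w
      ≈⟨ yw≈1 ⟩
    1# ∎

  module WeightedSums (x : Carrier) where

    u : ℕ → Carrier
    u j = (x + ι j) ⁻¹

    b : ℕ → Carrier
    b k = binom (x + ι k) k

    weight : ℕ → ℕ → Carrier
    weight n k = ι ((2 ℕ.* n ∸ k) C n) * b k

    Σw : ℕ → (ℕ → Carrier) → Carrier
    Σw n h = sum0 n (λ k → weight n k * h k)

    D : ℕ → Carrier
    D n = ι (suc n) * (x + ι (suc (suc n)))

    ρ : ℕ → Carrier
    ρ n = (x + ι (2 ℕ.+ 2 ℕ.* n)) * (x + ι (3 ℕ.+ 2 ℕ.* n))

    g : ℕ → ℕ → Carrier
    g n k = ((ι k * (x + ι (suc k))) * ι ((1 ℕ.+ 2 ℕ.* n ∸ k) C n)) * b k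

    B : ℕ → Carrier
    B n = binom (x + ι (2 ℕ.* n ℕ.+ 1)) n

    b-absorb : ∀ k → b (suc k) * ι (suc k) ≈ b k * (x + ι (suc k))
    b-absorb k = begin
      b (suc k) * ι (suc k)                    ≈⟨ binom-absorb k (x + ι (suc k)) ⟩
      (x + ι (suc k)) * binom (x + ι (suc k) - 1#) k  ≈⟨ *-congˡ (binom-cong k (+ι[1+m]-1≈+ιm x k)) ⟩
      (x + ι (suc k)) * b k                    ≈⟨ *-comm _ _ ⟩
      b k * (x + ι (suc k))                    ∎

    D*B[1+n]≈ρ*Bn : ∀ n → D n * B (suc n) ≈ ρ n * B n
    D*B[1+n]≈ρ*Bn n = begin
      (ι (suc n) * (x + ι (suc (suc n)))) * B (suc n)
        ≈⟨ solve 3 (λ a d c → (a :* d) :* c := d :* (c :* a)) refl _ _ _ ⟩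
      (x + ι (suc (suc n))) * (B (suc n) * ι (suc n))
        ≈⟨ *-cong (sym z-n≈x+n+2) (trans (*-congʳ (binom-cong (suc n) y≈)) (binom-absorb n y)) ⟩
      (z - ι n) * (y * binom (y - 1#) n)
        ≈⟨ *-congˡ (*-congˡ (binom-cong n (+ι[1+m]-1≈+ιm x (2 ℕ.+ 2 ℕ.* n)))) ⟩
      (z - ι n) * (y * binom z n)
        ≈⟨ solve 3 (λ d y c → d :* (y :* c) := y :* (c :* d)) refl _ y _ ⟩
      y * (binom z n * (z - ι n))
        ≈⟨ *-congˡ (binom-shift n z) ⟩
      y * (z * binom (z - 1#) n)
        ≈⟨ *-congˡ (*-congˡ (binom-cong n z-1≈)) ⟩
      y * (z * B n)
        ≈⟨ solve 3 (λ y z c → y :* (z :* c) := (z :* y) :* c) refl y z _ ⟩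
      ρ n * B n ∎
      where
      y = x + ι (3 ℕ.+ 2 ℕ.* n)
      z = x + ι (2 ℕ.+ 2 ℕ.* n)
      y≈ : x + ι (2 ℕ.* suc n ℕ.+ 1) ≈ y
      y≈ = +-congˡ (reflexive (≡.cong ι (≡.trans (NP.+-comm (2 ℕ.* suc n) 1) (≡.cong suc (NP.*-suc 2 n)))))
      z-1≈ : z - 1# ≈ x + ι (2 ℕ.* n ℕ.+ 1)
      z-1≈ = trans (+ι[1+m]-1≈+ιm x (1 ℕ.+ 2 ℕ.* n)) (+-congˡ (reflexive (≡.cong ι (NP.+-comm 1 (2 ℕ.* n)))))
      z-n≈x+n+2 : z - ι n ≈ x + ι (suc (suc n))
      z-n≈x+n+2 = begin
        x + (1# + (1# + ι (2 ℕ.* n))) - ι n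
          ≈⟨ +-congʳ (+-congˡ (+-congˡ (+-congˡ (ι-2* n)))) ⟩
        x + (1# + (1# + (ι n + ι n))) - ι n
          ≈⟨ solve 2 (λ x i → x :+ (κ 1 :+ (κ 1 :+ (i :+ i))) :- i := x :+ (κ 1 :+ (κ 1 :+ i))) refl x (ι n) ⟩
        x + ι (suc (suc n)) ∎

    weight-step : ∀ n k → k ≤ n → D n * weight (suc n) k ≈ ρ n * weight n k + (g n k - g n (suc k))
    weight-step n k k≤n = begin
      D n * (R * b k)
        ≈⟨ *-congʳ (*-cong (+-congˡ ιn≈N) (+-congˡ (+-congˡ (+-congˡ ιn≈N)))) ⟩
      ((1# + N) * (x + (1# + (1# + N)))) * (R * b k)
        ≈⟨ telescoping-certificate x K M P Q R (b k) (b (suc k)) hR hQ (b-absorb k) (char-zero m) ⟩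
      ((x + (1# + (1# + (N + N)))) * (x + (1# + (1# + (1# + (N + N)))))) * (P * b k) + (g n k - g n (suc k))
        ≈⟨ +-congʳ (*-congʳ (*-cong (+-congˡ (+-congˡ (+-congˡ ι2n≈N+N))) (+-congˡ (+-congˡ (+-congˡ (+-congˡ ι2n≈N+N)))))) ⟨
      ρ n * weight n k + (g n k - g n (suc k)) ∎
      where
      m = n ∸ k
      K = ι k
      M = ι m
      N = K + M
      p = (2 ℕ.* n ∸ k) C n
      q = (1 ℕ.+ 2 ℕ.* n ∸ k) C n
      r = (2 ℕ.* suc n ∸ k) C suc n
      P = ι p
      Q = ι q
      R = ι r
      ιn≈N : ι n ≈ N
      ιn≈N = trans (reflexive (≡.cong ι (≡.sym (NP.m+[n∸m]≡n k≤n)))) (ι-+ k m)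
      ι2n≈N+N : ι (2 ℕ.* n) ≈ N + N
      ι2n≈N+N = trans (ι-2* n) (+-cong ιn≈N ιn≈N)
      ι[n+m]≈N+M : ι (n ℕ.+ m) ≈ N + M
      ι[n+m]≈N+M = trans (ι-+ n m) (+-congʳ ιn≈N)
      hR : (1# + N) * R ≈ (1# + (1# + (N + M))) * Q
      hR = begin
        (1# + N) * R                     ≈⟨ *-congʳ (+-congˡ ιn≈N) ⟨
        ι (suc n) * R                    ≈⟨ ≡⇒ι*≈ι* (suc n) r (2 ℕ.+ (n ℕ.+ m)) q (C-absorb-2n∸k k≤n) ⟩
        ι (2 ℕ.+ (n ℕ.+ m)) * Q          ≈⟨ *-congʳ (+-congˡ (+-congˡ ι[n+m]≈N+M)) ⟩
        (1# + (1# + (N + M))) * Q        ∎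
      hQ : (1# + M) * Q ≈ (1# + (N + M)) * P
      hQ = trans (≡⇒ι*≈ι* (suc m) q (1 ℕ.+ (n ℕ.+ m)) p (C-absorb′-2n∸k k≤n)) (*-congʳ (+-congˡ ι[n+m]≈N+M))

    g-zero : ∀ n → g n 0 ≈ 0#
    g-zero n = solve 3 (λ X c b → ((κ 0 :* X) :* c) :* b := κ 0) refl _ _ _

    weight-boundary : ∀ n → D n * weight (suc n) (suc n) ≈ g n (suc n)
    weight-boundary n = begin
      D n * (ι ((2 ℕ.* suc n ∸ suc n) C suc n) * b (suc n))  ≈⟨ *-congˡ (*-congʳ (ι[2n∸n]Cn≈1 (suc n))) ⟩
      D n * (1# * b (suc n))                                 ≈⟨ solve 2 (λ d b → d :* (κ 1 :* b) := (d :* κ 1) :* b) refl _ _ ⟩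
      (D n * 1#) * b (suc n)                                 ≈⟨ *-congʳ (*-congˡ (ι[2n∸n]Cn≈1 n)) ⟨
      g n (suc n)                                            ∎

    Σw-step : ∀ n h → D n * Σw (suc n) h ≈ ρ n * Σw n h + sum0 n (λ j → g n (suc j) * (h (suc j) - h j))
    Σw-step n h = creative-telescoping n (weight n) (weight (suc n)) (g n) h (weight-step n) (weight-boundary n) (g-zero n)

    g-suc : ∀ n j → g n (suc j) ≈ weight n j * ((x + ι (suc j)) * (x + ι (suc (suc j))))
    g-suc n j = begin
      ((ι (suc j) * (x + ι (suc (suc j)))) * P) * b (suc j)
        ≈⟨ solve 4 (λ i y P b → ((i :* y) :* P) :* b := P :* ((b :* i) :* y)) refl _ _ P _ ⟩
      P * ((b (suc j) * ι (suc j)) * (x + ι (suc (suc j))))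
        ≈⟨ *-congˡ (*-congʳ (b-absorb j)) ⟩
      P * ((b j * (x + ι (suc j))) * (x + ι (suc (suc j))))
        ≈⟨ solve 4 (λ P b y z → P :* ((b :* y) :* z) := (P :* b) :* (y :* z)) refl P _ _ _ ⟩
      weight n j * ((x + ι (suc j)) * (x + ι (suc (suc j)))) ∎
      where P = ι ((2 ℕ.* n ∸ j) C n)

    NoPoleUpTo : ℕ → Set ℓ
    NoPoleUpTo M = ∀ j → 1 ≤ j → j ≤ M → ¬ (x + ι j ≈ 0#)

    NoPoleUpTo-≤ : ∀ {M M′} → M ≤ M′ → NoPoleUpTo M′ → NoPoleUpTo M
    NoPoleUpTo-≤ M≤M′ np j 1≤j j≤M = np j 1≤j (NP.≤-trans j≤M M≤M′)

    u-inverse : ∀ {M} → NoPoleUpTo M → ∀ j → 1 ≤ j → j ≤ M → (x + ι j) * u j ≈ 1#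
    u-inverse np j 1≤j j≤M = ⁻¹-inverse _ (np j 1≤j j≤M)

    2+j≤3+2n : ∀ {j n} → j ≤ n → 2 ℕ.+ j ≤ 3 ℕ.+ 2 ℕ.* n
    2+j≤3+2n {j} {n} j≤n = ℕ.s≤s (ℕ.s≤s (NP.m≤n⇒m≤1+n (NP.≤-trans j≤n (NP.m≤m+n n (n ℕ.+ 0)))))

    1+j≤3+2n : ∀ {j n} → j ≤ n → 1 ℕ.+ j ≤ 3 ℕ.+ 2 ℕ.* n
    1+j≤3+2n j≤n = NP.≤-trans (NP.n≤1+n _) (2+j≤3+2n j≤n)

    D≉0 : ∀ n → NoPoleUpTo (3 ℕ.+ 2 ℕ.* n) → ¬ (D n ≈ 0#)
    D≉0 n np = *-≉0 (char-zero n) (np (suc (suc n)) (ℕ.s≤s ℕ.z≤n) (2+j≤3+2n NP.≤-refl))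

    V N L : ℕ → Carrier
    V n = Σw n (λ _ → 1#)
    N n = Σw n (λ k → u (suc k))
    L n = Σw n (λ k → Hgen 2 k x)

    V-step : ∀ n → D n * V (suc n) ≈ ρ n * V n
    V-step n = begin
      D n * V (suc n)
        ≈⟨ Σw-step n (λ _ → 1#) ⟩
      ρ n * V n + sum0 n (λ j → g n (suc j) * (1# - 1#))
        ≈⟨ +-congˡ (sum0-≈0 n (λ j → trans (*-congˡ (-‿inverseʳ 1#)) (zeroʳ _))) ⟩
      ρ n * V n + 0#
        ≈⟨ +-identityʳ _ ⟩
      ρ n * V n ∎

    N-step : ∀ n → NoPoleUpTo (3 ℕ.+ 2 ℕ.* n) → D n * N (suc n) ≈ ρ n * N n - V n
    N-step n np = begin
      D n * N (suc n)                                                      ≈⟨ Σw-step n (λ k → u (suc k)) ⟩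
      ρ n * N n + sum0 n (λ j → g n (suc j) * (u (suc (suc j)) - u (suc j))) ≈⟨ +-congˡ (sum0-cong n difference) ⟩
      ρ n * N n + sum0 n (λ j → - (weight n j * 1#))                       ≈⟨ +-congˡ (-‿sum0 n _) ⟩
      ρ n * N n - V n                                                      ∎
      where
      difference : ∀ j → j ≤ n → g n (suc j) * (u (suc (suc j)) - u (suc j)) ≈ - (weight n j * 1#)
      difference j j≤n = begin
        g n (suc j) * (u (suc (suc j)) - u (suc j))
          ≈⟨ *-congʳ (g-suc n j) ⟩
        (weight n j * ((x + ι (suc j)) * (x + ι (suc (suc j))))) * (u (suc (suc j)) - u (suc j))
          ≈⟨ *-assoc _ _ _ ⟩
        weight n j * (((x + ι (suc j)) * (x + ι (suc (suc j)))) * (u (suc (suc j)) - u (suc j)))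
          ≈⟨ *-congˡ (reciprocal-difference x (ι (suc j)) _ _ (u-inverse np _ (ℕ.s≤s ℕ.z≤n) (1+j≤3+2n j≤n))
                                                                (u-inverse np _ (ℕ.s≤s ℕ.z≤n) (2+j≤3+2n j≤n))) ⟩
        weight n j * - 1#
          ≈⟨ solve 1 (λ c → c :* (:- κ 1) := :- (c :* κ 1)) refl _ ⟩
        - (weight n j * 1#) ∎

    L-step : ∀ n → NoPoleUpTo (3 ℕ.+ 2 ℕ.* n) → D n * L (suc n) ≈ ρ n * L n + (V n + N n)
    L-step n np = begin
      D n * L (suc n)                                                         ≈⟨ Σw-step n (λ k → Hgen 2 k x) ⟩
      ρ n * L n + sum0 n (λ j → g n (suc j) * (Hgen 2 (suc j) x - Hgen 2 j x)) ≈⟨ +-congˡ (sum0-cong n difference) ⟩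
      ρ n * L n + sum0 n (λ j → weight n j * 1# + weight n j * u (suc j))     ≈⟨ +-congˡ (sum0-+ n _ _) ⟩
      ρ n * L n + (V n + N n)                                                 ∎
      where
      difference : ∀ j → j ≤ n → g n (suc j) * (Hgen 2 (suc j) x - Hgen 2 j x) ≈ weight n j * 1# + weight n j * u (suc j)
      difference j j≤n = begin
        g n (suc j) * ((Hgen 2 j x + 1# / pow (x + ι (suc j)) 2) - Hgen 2 j x)
          ≈⟨ *-cong (g-suc n j) (solve 2 (λ h f → (h :+ f) :- h := f) refl _ _) ⟩
        (weight n j * ((x + ι (suc j)) * (x + ι (suc (suc j))))) * (1# / pow (x + ι (suc j)) 2)
          ≈⟨ *-congˡ (1/pow≈pow 2 w-inverse) ⟩
        (weight n j * ((x + ι (suc j)) * (x + ι (suc (suc j))))) * (w * (w * 1#))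
          ≈⟨ solve 3 (λ c p w → (c :* p) :* (w :* (w :* κ 1)) := c :* (p :* (w :* w))) refl _ _ w ⟩
        weight n j * (((x + ι (suc j)) * (x + ι (suc (suc j)))) * (w * w))
          ≈⟨ *-congˡ (reciprocal-square x (ι (suc j)) w w-inverse) ⟩
        weight n j * (1# + w)
          ≈⟨ distribˡ _ _ _ ⟩
        weight n j * 1# + weight n j * w ∎
        where
        w = u (suc j)
        w-inverse = u-inverse np _ (ℕ.s≤s ℕ.z≤n) (1+j≤3+2n j≤n)

    -- A n = Σ_{j=1}^{2n+1} (−1)^{j+1}/(x+j) and S n = Σ_{j=1}^{2n+1} 1/(x+j)².
    A S : ℕ → Carrier
    A zero    = u 1
    A (suc n) = (A n - u (2 ℕ.+ 2 ℕ.* n)) + u (3 ℕ.+ 2 ℕ.* n)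
    S zero    = u 1 * u 1
    S (suc n) = (S n + u (2 ℕ.+ 2 ℕ.* n) * u (2 ℕ.+ 2 ℕ.* n)) + u (3 ℕ.+ 2 ℕ.* n) * u (3 ℕ.+ 2 ℕ.* n)

    ρ*[u₃-u₂]≈-1 : ∀ n → NoPoleUpTo (3 ℕ.+ 2 ℕ.* n) → ρ n * (u (3 ℕ.+ 2 ℕ.* n) - u (2 ℕ.+ 2 ℕ.* n)) ≈ - 1#
    ρ*[u₃-u₂]≈-1 n np = reciprocal-difference x (ι (2 ℕ.+ 2 ℕ.* n)) _ _
      (u-inverse np _ (ℕ.s≤s ℕ.z≤n) (NP.n≤1+n _)) (u-inverse np _ (ℕ.s≤s ℕ.z≤n) NP.≤-refl)

    ρ*[S-A²]-step : ∀ n → NoPoleUpTo (3 ℕ.+ 2 ℕ.* n) →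
      ρ n * (S (suc n) - A (suc n) * A (suc n)) ≈ ρ n * (S n - A n * A n) + ((1# + 1#) + (A n + A n))
    ρ*[S-A²]-step n np = begin
      (p * q) * (((S n + w * w) + v * v) - ((A n - w) + v) * ((A n - w) + v))
        ≈⟨ solve 6 (λ p q w v s a → (p :* q) :* (((s :+ w :* w) :+ v :* v) :- ((a :- w) :+ v) :* ((a :- w) :+ v))
                                := (p :* q) :* (s :- a :* a) :+ κ 2 :* ((p :* w) :* (q :* v)) :- (a :+ a) :* ((p :* q) :* (v :- w))) refl p q w v (S n) (A n) ⟩
      (p * q) * (S n - A n * A n) + (1# + 1#) * ((p * w) * (q * v)) - (A n + A n) * ((p * q) * (v - w))
        ≈⟨ +-cong (+-congˡ (*-congˡ (*-cong p*w≈1 q*v≈1))) (-‿cong (*-congˡ (ρ*[u₃-u₂]≈-1 n np))) ⟩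
      (p * q) * (S n - A n * A n) + (1# + 1#) * (1# * 1#) - (A n + A n) * - 1#
        ≈⟨ solve 2 (λ r a → r :+ κ 2 :* (κ 1 :* κ 1) :- (a :+ a) :* (:- κ 1) := r :+ (κ 2 :+ (a :+ a))) refl _ (A n) ⟩
      (p * q) * (S n - A n * A n) + ((1# + 1#) + (A n + A n)) ∎
      where
      p = x + ι (2 ℕ.+ 2 ℕ.* n)
      q = x + ι (3 ℕ.+ 2 ℕ.* n)
      w = u (2 ℕ.+ 2 ℕ.* n)
      v = u (3 ℕ.+ 2 ℕ.* n)
      p*w≈1 = u-inverse np _ (ℕ.s≤s ℕ.z≤n) (NP.n≤1+n _)
      q*v≈1 = u-inverse np _ (ℕ.s≤s ℕ.z≤n) NP.≤-refl

    NoPoleUpTo-suc : ∀ n → NoPoleUpTo (1 ℕ.+ 2 ℕ.* suc n) → NoPoleUpTo (3 ℕ.+ 2 ℕ.* n)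
    NoPoleUpTo-suc n = ≡.subst (λ M → NoPoleUpTo (suc M)) (NP.*-suc 2 n)

    NoPoleUpTo-pred : ∀ n → NoPoleUpTo (3 ℕ.+ 2 ℕ.* n) → NoPoleUpTo (1 ℕ.+ 2 ℕ.* n)
    NoPoleUpTo-pred n = NoPoleUpTo-≤ (NP.m≤n⇒m≤1+n (NP.n≤1+n _))

    V≈B : ∀ n → NoPoleUpTo (1 ℕ.+ 2 ℕ.* n) → V n ≈ B n
    V≈B zero    np = solve 1 (λ w → ((κ 1 :+ κ 0) :* (κ 1 :* w)) :* κ 1 := κ 1 :* w) refl _
    V≈B (suc n) np = *-cancelˡ (D≉0 n np′) (begin
      D n * V (suc n)   ≈⟨ V-step n ⟩
      ρ n * V n         ≈⟨ *-congˡ (V≈B n (NoPoleUpTo-pred n np′)) ⟩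
      ρ n * B n         ≈⟨ D*B[1+n]≈ρ*Bn n ⟨
      D n * B (suc n)   ∎)
      where np′ = NoPoleUpTo-suc n np

    N≈V*A : ∀ n → NoPoleUpTo (1 ℕ.+ 2 ℕ.* n) → N n ≈ V n * A n
    N≈V*A zero    np = solve 2 (λ c w → c :* w := (c :* κ 1) :* w) refl _ _
    N≈V*A (suc n) np = *-cancelˡ (D≉0 n np′) (begin
      D n * N (suc n)                    ≈⟨ N-step n np′ ⟩
      ρ n * N n - V n                    ≈⟨ +-congʳ (*-congˡ (N≈V*A n (NoPoleUpTo-pred n np′))) ⟩
      ρ n * (V n * A n) - V n            ≈⟨ solve 3 (λ r v a → r :* (v :* a) :- v := (r :* v) :* a :+ v :* (:- κ 1)) refl _ _ _ ⟩
      (ρ n * V n) * A n + V n * - 1#     ≈⟨ +-congˡ (*-congˡ (ρ*[u₃-u₂]≈-1 n np′)) ⟨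
      (ρ n * V n) * A n + V n * (ρ n * (v - w))
        ≈⟨ solve 5 (λ r c a w v → (r :* c) :* a :+ c :* (r :* (v :- w)) := (r :* c) :* ((a :- w) :+ v)) refl _ _ _ w v ⟩
      (ρ n * V n) * A (suc n)            ≈⟨ *-congʳ (V-step n) ⟨
      (D n * V (suc n)) * A (suc n)      ≈⟨ *-assoc _ _ _ ⟩
      D n * (V (suc n) * A (suc n))      ∎)
      where
      np′ = NoPoleUpTo-suc n np
      w = u (2 ℕ.+ 2 ℕ.* n)
      v = u (3 ℕ.+ 2 ℕ.* n)

    2L≈V*[S-A²] : ∀ n → NoPoleUpTo (1 ℕ.+ 2 ℕ.* n) → L n + L n ≈ V n * (S n - A n * A n)
    2L≈V*[S-A²] zero    np = solve 2 (λ c w → c :* κ 0 :+ c :* κ 0 := (c :* κ 1) :* (w :* w :- w :* w)) refl _ _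
    2L≈V*[S-A²] (suc n) np = *-cancelˡ (D≉0 n np′) (begin
      D n * (L (suc n) + L (suc n))
        ≈⟨ distribˡ _ _ _ ⟩
      D n * L (suc n) + D n * L (suc n)
        ≈⟨ +-cong (L-step n np′) (L-step n np′) ⟩
      (ρ n * L n + (V n + N n)) + (ρ n * L n + (V n + N n))
        ≈⟨ solve 4 (λ r l c m → (r :* l :+ (c :+ m)) :+ (r :* l :+ (c :+ m)) := r :* (l :+ l) :+ ((c :+ c) :+ (m :+ m))) refl _ _ _ _ ⟩
      ρ n * (L n + L n) + ((V n + V n) + (N n + N n))
        ≈⟨ +-cong (*-congˡ (2L≈V*[S-A²] n np″)) (+-congˡ (+-cong (N≈V*A n np″) (N≈V*A n np″))) ⟩
      ρ n * (V n * (S n - A n * A n)) + ((V n + V n) + (V n * A n + V n * A n))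
        ≈⟨ solve 4 (λ r c a t → r :* (c :* t) :+ ((c :+ c) :+ (c :* a :+ c :* a)) := c :* (r :* t :+ (κ 2 :+ (a :+ a)))) refl _ _ _ _ ⟩
      V n * (ρ n * (S n - A n * A n) + ((1# + 1#) + (A n + A n)))
        ≈⟨ *-congˡ (ρ*[S-A²]-step n np′) ⟨
      V n * (ρ n * (S (suc n) - A (suc n) * A (suc n)))
        ≈⟨ solve 3 (λ c r t → c :* (r :* t) := (r :* c) :* t) refl _ _ _ ⟩
      (ρ n * V n) * (S (suc n) - A (suc n) * A (suc n))
        ≈⟨ *-congʳ (V-step n) ⟨
      (D n * V (suc n)) * (S (suc n) - A (suc n) * A (suc n))
        ≈⟨ *-assoc _ _ _ ⟩
      D n * (V (suc n) * (S (suc n) - A (suc n) * A (suc n))) ∎)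
      where
      np′ = NoPoleUpTo-suc n np
      np″ = NoPoleUpTo-pred n np′

    H⁽²⁾₂ₙ[x+1]≈S-u₁² : ∀ n → NoPoleUpTo (1 ℕ.+ 2 ℕ.* n) → Hgen 2 (2 ℕ.* n) (x + 1#) ≈ S n - u 1 * u 1
    H⁽²⁾₂ₙ[x+1]≈S-u₁² zero    np = solve 1 (λ w → κ 0 := w :* w :- w :* w) refl _
    H⁽²⁾₂ₙ[x+1]≈S-u₁² (suc n) np = begin
      Hgen 2 (2 ℕ.* suc n) (x + 1#)                  ≡⟨ ≡.cong (λ t → Hgen 2 t (x + 1#)) (NP.*-suc 2 n) ⟩
      (Hgen 2 (2 ℕ.* n) (x + 1#) + f (1 ℕ.+ 2 ℕ.* n)) + f (2 ℕ.+ 2 ℕ.* n)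
        ≈⟨ +-cong (+-cong (H⁽²⁾₂ₙ[x+1]≈S-u₁² n (NoPoleUpTo-pred n np′)) (f≈u² (ℕ.s≤s ℕ.z≤n) (NP.n≤1+n _)))
                  (f≈u² (ℕ.s≤s ℕ.z≤n) NP.≤-refl) ⟩
      ((S n - u 1 * u 1) + w * (w * 1#)) + v * (v * 1#)
        ≈⟨ solve 4 (λ s a w v → ((s :- a :* a) :+ w :* (w :* κ 1)) :+ v :* (v :* κ 1)
                             := ((s :+ w :* w) :+ v :* v) :- a :* a) refl _ _ _ _ ⟩
      S (suc n) - u 1 * u 1                          ∎
      where
      np′ = NoPoleUpTo-suc n np
      w = u (2 ℕ.+ 2 ℕ.* n)
      v = u (3 ℕ.+ 2 ℕ.* n)
      f : ℕ → Carrier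
      f m = 1# / pow ((x + 1#) + ι m) 2
      f≈u² : ∀ {m} → 1 ≤ suc m → suc m ≤ 3 ℕ.+ 2 ℕ.* n → f m ≈ u (suc m) * (u (suc m) * 1#)
      f≈u² {m} 1≤ ≤3+2n = 1/pow≈pow 2 (trans (*-congʳ (+-assoc x 1# (ι m))) (u-inverse np′ (suc m) 1≤ ≤3+2n))

    H[x/2]-H[[x+1]/2]≈2[u₁-A] : ∀ n → NoPoleUpTo (1 ℕ.+ 2 ℕ.* n) →
      H n (x / ι 2) - H n ((x + 1#) / ι 2) ≈ ι 2 * (u 1 - A n)
    H[x/2]-H[[x+1]/2]≈2[u₁-A] zero    np = solve 1 (λ w → κ 0 :- κ 0 := ιᴾ 2 :* (w :- w)) refl _
    H[x/2]-H[[x+1]/2]≈2[u₁-A] (suc n) np = begin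
      (H n a + 1# / pow (a + ι (suc n)) 1) - (H n a′ + 1# / pow (a′ + ι (suc n)) 1)
        ≈⟨ solve 4 (λ h r h′ r′ → (h :+ r) :- (h′ :+ r′) := (h :- h′) :+ (r :- r′)) refl _ _ _ _ ⟩
      (H n a - H n a′) + (1# / pow (a + ι (suc n)) 1 - 1# / pow (a′ + ι (suc n)) 1)
        ≈⟨ +-cong (H[x/2]-H[[x+1]/2]≈2[u₁-A] n (NoPoleUpTo-pred n np′)) (+-cong 1/[a+n+1]≈2w (-‿cong 1/[a′+n+1]≈2v)) ⟩
      ι 2 * (u 1 - A n) + ((ι 2 * w) * 1# - (ι 2 * v) * 1#)
        ≈⟨ solve 4 (λ u₁ a w v → ιᴾ 2 :* (u₁ :- a) :+ ((ιᴾ 2 :* w) :* κ 1 :- (ιᴾ 2 :* v) :* κ 1)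
                              := ιᴾ 2 :* (u₁ :- ((a :- w) :+ v))) refl _ _ _ _ ⟩
      ι 2 * (u 1 - A (suc n)) ∎
      where
      np′ = NoPoleUpTo-suc n np
      a = x / ι 2
      a′ = (x + 1#) / ι 2
      w = u (2 ℕ.+ 2 ℕ.* n)
      v = u (3 ℕ.+ 2 ℕ.* n)
      ι[2[1+n]] : ∀ {y} → y + ι (2 ℕ.* suc n) ≈ y + ι (2 ℕ.+ 2 ℕ.* n)
      ι[2[1+n]] = +-congˡ (reflexive (≡.cong ι (NP.*-suc 2 n)))
      1/[a+n+1]≈2w : 1# / pow (a + ι (suc n)) 1 ≈ (ι 2 * w) * 1#
      1/[a+n+1]≈2w = 1/pow≈pow 1 (half-shift-inverse x (suc n) w
        (trans (*-congʳ ι[2[1+n]]) (u-inverse np′ _ (ℕ.s≤s ℕ.z≤n) (NP.n≤1+n _))))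
      1/[a′+n+1]≈2v : 1# / pow (a′ + ι (suc n)) 1 ≈ (ι 2 * v) * 1#
      1/[a′+n+1]≈2v = 1/pow≈pow 1 (half-shift-inverse (x + 1#) (suc n) v
        (trans (*-congʳ (trans ι[2[1+n]] (+-assoc x 1# _))) (u-inverse np′ _ (ℕ.s≤s ℕ.z≤n) NP.≤-refl)))

theorem4 : ∀ {c ℓ} (F : CharZeroField c ℓ) →
  let open CharZeroField F in
  let open Notation F in
  (x : Carrier) (n : ℕ) →
  (∀ k → 1 ≤ k → k ≤ n → ¬ (x + ι k ≈ 0#)) →
  (∀ k → 1 ≤ k → k ≤ 2 ℕ.* n → ¬ ((x + 1#) + ι k ≈ 0#)) →
  (∀ k → 1 ≤ k → k ≤ n → ¬ (x / ι 2 + ι k ≈ 0#)) →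
  (∀ k → 1 ≤ k → k ≤ n → ¬ ((x + 1#) / ι 2 + ι k ≈ 0#)) →
  ¬ (x + 1# ≈ 0#) →
  sum0 n (λ k → (ι ((2 ℕ.* n ∸ k) C n) * binom (x + ι k) k) * Hgen 2 k x)
    ≈ (binom (x + ι (2 ℕ.* n ℕ.+ 1)) n / ι 8)
      * (ι 4 * Hgen 2 (2 ℕ.* n) (x + 1#)
         - (H n (x / ι 2) - H n ((x + 1#) / ι 2))
           * ((H n (x / ι 2) - H n ((x + 1#) / ι 2)) - ι 4 / (x + 1#)))
-- Only the poles x + j, 1 ≤ j ≤ 2n+1, matter; the other hypotheses are special cases of these
-- (x/2 + k = (x + 2k)/2 and (x+1)/2 + k = (x + 2k + 1)/2).
theorem4 F x n _ x+1+k≉0 _ _ x+1≉0 = sym (begin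
  (B n / ι 8) * (ι 4 * Hgen 2 (2 ℕ.* n) (x + 1#) - d * (d - ι 4 / (x + 1#)))
    ≈⟨ *-cong (*-congʳ (sym (V≈B n np)))
              (+-cong (*-congˡ (H⁽²⁾₂ₙ[x+1]≈S-u₁² n np)) (-‿cong (*-cong d≈ (+-cong d≈ (-‿cong 4/[x+1]≈4u₁))))) ⟩
  (V n / ι 8) * (ι 4 * (S n - u 1 * u 1) - (ι 2 * (u 1 - A n)) * (ι 2 * (u 1 - A n) - ι 4 * u 1))
    ≈⟨ solve 5 (λ v e s w a → (v :* e) :* (ιᴾ 4 :* (s :- w :* w) :- (ιᴾ 2 :* (w :- a)) :* (ιᴾ 2 :* (w :- a) :- ιᴾ 4 :* w))
                            := e :* (ιᴾ 4 :* (v :* (s :- a :* a)))) refl _ _ _ _ _ ⟩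
  ι 8 ⁻¹ * (ι 4 * (V n * (S n - A n * A n)))
    ≈⟨ *-congˡ (*-congˡ (2L≈V*[S-A²] n np)) ⟨
  ι 8 ⁻¹ * (ι 4 * (L n + L n))
    ≈⟨ solve 2 (λ e l → e :* (ιᴾ 4 :* (l :+ l)) := (ιᴾ 8 :* e) :* l) refl _ _ ⟩
  (ι 8 * ι 8 ⁻¹) * L n
    ≈⟨ trans (*-congʳ (⁻¹-inverse _ (char-zero 7))) (*-identityˡ _) ⟩
  L n ∎)
  where
  open CharZeroField F
  open Notation F
  open IntegerCoefficientSolver commRing
  open WeightedSums F x
  open import Relation.Binary.Reasoning.Setoid setoid
  d = H n (x / ι 2) - H n ((x + 1#) / ι 2)
  np : NoPoleUpTo (1 ℕ.+ 2 ℕ.* n)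
  np (suc zero)    _ _           x+1≈0 = x+1≉0 (trans (+-congˡ (sym (+-identityʳ 1#))) x+1≈0)
  np (suc (suc k)) _ (ℕ.s≤s k<2n) x+k≈0 = x+1+k≉0 (suc k) (ℕ.s≤s ℕ.z≤n) k<2n (trans (+-assoc x 1# _) x+k≈0)
  d≈ : d ≈ ι 2 * (u 1 - A n)
  d≈ = H[x/2]-H[[x+1]/2]≈2[u₁-A] n np
  4/[x+1]≈4u₁ : ι 4 / (x + 1#) ≈ ι 4 * u 1
  4/[x+1]≈4u₁ = *-congˡ (⁻¹-cong (+-congˡ (sym (+-identityʳ 1#))))
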